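{- Let $n,r\in\mathbb{N}$, let $A\subseteq[n]$ and let $x\in A$. Suppose that the link graph $L_x[A\setminus\{x\}]$ contains a matching of size $m$. Then $$f(A,r)\le (r^2-1)^m\cdot r^{|A|-2m}.$$
   Context: $[n]=\{1,\ldots,n\}$. A Schur triple in $S\subseteq\mathbb{Z}$ is a triple $\{x,y,z\}\subseteq S$ of not necessarily distinct elements with $x+y=z$; a set is sum-free if it contains no Schur triple. For $A\subseteq[n]$, a colouring $\sigma:A\to[r]$ is valid if each colour class $\sigma^{ -1}(c)$ is sum-free; $f(A,r)$ is the number of valid colourings. For $S,B\subseteq[n]$, the link graph $L_S[B]$ is the simple graph with vertex set $B$ in which distinct $u,v\in B$ are adjacent if and only if there is $z\in S$ such that $\{u,v,z\}$ is a Schur triple with $u,v,z$ pairwise distinct; $L_x[B]:=L_{\{x\}}[B]$. -}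

module Defs where

open import Data.Nat using (ℕ; zero; suc; _+_)
import Data.Nat
open import Data.Fin using (Fin; toℕ)
open import Data.Fin.Properties using (all?) renaming (_≟_ to _≟ᶠ_)
open import Data.Fin.Subset using (Subset; _∈_; _∉_; ⁅_⁆; _─_)
open import Data.Fin.Subset.Properties using (_∈?_)
open import Data.Maybe using (Maybe; just; nothing)
import Data.Maybe.Properties as MaybeP
open import Data.Vec using (Vec; []; _∷_; lookup)
open import Data.List using (List; []; _∷_; length; filter; concatMap; map)
open import Data.Product using (_×_; ∃-syntax; _,_)
open import Data.Sum using (_⊎_)
open import Data.Empty using (⊥)
open import Relation.Nullary using (¬_; Dec; yes; no)
open import Relation.Nullary.Decidable using (_×-dec_; _→-dec_; ¬?; _⊎-dec_)
open import Relation.Binary.PropositionalEquality using (_≡_; _≢_)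
open import Function.Definitions using (Injective)
open import Data.Sum using ([_,_])

-- The ground set [n] = {1,…,n} is represented by Fin n, where i : Fin n
-- stands for the natural number  val i = toℕ i + 1.  Subsets A ⊆ [n] are
-- therefore  Subset n  (Data.Fin.Subset), and |A| is  ∣ A ∣ .
val : {n : ℕ} → Fin n → ℕ
val i = suc (toℕ i)

-- {a,b,c} (not necessarily distinct) is a Schur triple: some ordering
-- satisfies x + y = z  (orderings differing by x↔y are identical, so three
-- cases suffice).
IsSchurTriple : ℕ → ℕ → ℕ → Set
IsSchurTriple a b c = (a + b ≡ c) ⊎ (a + c ≡ b) ⊎ (b + c ≡ a)

-- A colouring σ : A → [r] is represented as a vector  Vec (Maybe (Fin r)) n
-- whose entry at i is  just (σ i)  for i ∈ A and  nothing  for i ∉ A.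
-- This is a bijective encoding of the functions A → Fin r.

IsColouringOf : {n r : ℕ} → Subset n → Vec (Maybe (Fin r)) n → Set
IsColouringOf {n} A σ =
  (i : Fin n) → (i ∈ A → ∃[ c ] lookup σ i ≡ just c) × (i ∉ A → lookup σ i ≡ nothing)

IsValid : {n r : ℕ} → Subset n → Vec (Maybe (Fin r)) n → Set
IsValid {n} A σ =
  (i j k : Fin n) → i ∈ A → j ∈ A → k ∈ A → val i + val j ≡ val k →
  ¬ (lookup σ i ≡ lookup σ j × lookup σ j ≡ lookup σ k)

IsValidColouring : {n r : ℕ} → Subset n → Vec (Maybe (Fin r)) n → Set
IsValidColouring A σ = IsColouringOf A σ × IsValid A σ

private
  _≟ᵐ_ : {r : ℕ} → (a b : Maybe (Fin r)) → Dec (a ≡ b)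
  _≟ᵐ_ = MaybeP.≡-dec _≟ᶠ_

  _≟ℕ_ : (a b : ℕ) → Dec (a ≡ b)
  _≟ℕ_ = Data.Nat._≟_

  ∃c? : {r : ℕ} (m : Maybe (Fin r)) → Dec (∃[ c ] m ≡ just c)
  ∃c? (just c) = yes (c , _≡_.refl)
  ∃c? nothing = no λ { (_ , ()) }

isValidColouring? : {n r : ℕ} (A : Subset n) (σ : Vec (Maybe (Fin r)) n) →
                    Dec (IsValidColouring A σ)
isValidColouring? A σ =
  all? (λ i → ((i ∈? A) →-dec ∃c? (lookup σ i)) ×-dec (¬? (i ∈? A) →-dec (lookup σ i ≟ᵐ nothing)))
  ×-dec
  all? (λ i → all? (λ j → all? (λ k →
    (i ∈? A) →-dec ((j ∈? A) →-dec ((k ∈? A) →-dec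
      (((val i + val j) ≟ℕ val k) →-dec
        ¬? ((lookup σ i ≟ᵐ lookup σ j) ×-dec (lookup σ j ≟ᵐ lookup σ k))))))))

allFinList : (r : ℕ) → List (Fin r)
allFinList zero = []
allFinList (suc r) = Fin.zero ∷ map Fin.suc (allFinList r)

allMaybe : (r : ℕ) → List (Maybe (Fin r))
allMaybe r = nothing ∷ map just (allFinList r)

allVecs : (r n : ℕ) → List (Vec (Maybe (Fin r)) n)
allVecs r zero = [] ∷ []
allVecs r (suc n) = concatMap (λ a → map (a ∷_) (allVecs r n)) (allMaybe r)

f : {n : ℕ} → Subset n → ℕ → ℕ
f {n} A r = length (filter (isValidColouring? A) (allVecs r n))

LinkAdj : {n : ℕ} → Subset n → Subset n → Fin n → Fin n → Set
LinkAdj {n} S B u v =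
  u ∈ B × v ∈ B × u ≢ v ×
  ∃[ z ] (z ∈ S × u ≢ z × v ≢ z × IsSchurTriple (val u) (val v) (val z))

record Matching {n : ℕ} (S B : Subset n) (m : ℕ) : Set where
  field
    u v      : Fin m → Fin n
    edge     : (k : Fin m) → LinkAdj S B (u k) (v k)
    disjoint : Injective _≡_ _≡_ [ u , v ]

LinkMatching : {n : ℕ} → Fin n → Subset n → ℕ → Set
LinkMatching x B m = Matching ⁅ x ⁆ B m

-- Encode a valid colouring σ by the colours of the unmatched vertices of A (x among them)
-- together with the colour pair (σ u, σ v) of every matching edge uv. Since {u, v, x} is a
-- Schur triple, that pair is never (σ x, σ x), so once σ x is known it takes one of r² − 1
-- values. The encoding is injective, and the 2m matched vertices are distinct, so there are at
-- most (r² − 1)^m · r^(|A| − 2m) codes.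
module Submission where

open import Defs
open import Level using (0ℓ)
open import Data.Nat using (ℕ; zero; suc; _+_; _*_; _^_; _∸_; _≤_; z≤n; s≤s)
open import Data.Nat.Properties using (≤-refl; ≤-reflexive; ≤-trans; +-comm; +-identityʳ; *-identityʳ;
  m+n≤o⇒m≤o∸n; *-monoʳ-≤; ^-monoʳ-≤; module ≤-Reasoning)
open import Data.Fin using (Fin; zero; suc; combine; funToFin; finToFun; punchOut; splitAt; join)
open import Data.Fin.Properties using (injective⇒≤; suc-injective; 0≢1+n; _≟_; combine-injective;
  combine-injectiveˡ; combine-injectiveʳ; finToFun-funToFin; punchOut-injective; join-splitAt)
open import Data.Fin.Subset using (Subset; inside; outside; _∈_; _∉_; _─_; _-_; ⁅_⁆; ∣_∣)
open import Data.Fin.Subset.Properties using (x∈p∧x≢y⇒x∈p-y; x∈p⇒∣p-x∣<∣p∣; p─q⊆p; x∈⁅x⁆; x∈⁅y⁆⇒x≡y;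
  _∈?_)
open import Data.Product using (∃-syntax; _×_; _,_; proj₁; proj₂)
open import Data.Sum using (inj₁; inj₂; [_,_])
open import Data.Empty using (⊥)
open import Data.Maybe using (Maybe; just; fromMaybe)
open import Data.Maybe.Properties using (just-injective)
open import Data.List using (List; []; _∷_; length; filter; map; concatMap; cartesianProductWith; _++_)
import Data.List as List
open import Data.List.Properties using (filter-none)
import Data.List.Relation.Unary.All as All
open import Data.List.Relation.Unary.All.Properties using (all-filter; map⁺)
open import Data.List.Relation.Unary.Unique.Propositional using (Unique; _∷_; [])
open import Data.List.Relation.Unary.Unique.Propositional.Properties using (filter⁺; cartesianProductWith⁺)
  renaming (map⁺ to unique-map⁺)
open import Data.List.Membership.Propositional.Properties using (∈-lookup)
open import Data.Vec using (Vec; []; _∷_; lookup; here; there)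
open import Data.Vec.Properties using (∷-injective)
open import Data.Vec.Relation.Binary.Pointwise.Extensional using (ext; Pointwise-≡⇒≡)
open import Function using (_∘_)
open import Function.Definitions using (Injective)
open import Relation.Nullary using (¬_; yes; no; contradiction)
open import Relation.Unary using (Pred; Decidable)
open import Relation.Binary.PropositionalEquality using (_≡_; _≢_; refl; sym; trans; cong; subst;
  module ≡-Reasoning)

Unique⇒lookup-injective : {A : Set} {xs : List A} → Unique xs →
                          ∀ i j → List.lookup xs i ≡ List.lookup xs j → i ≡ j
Unique⇒lookup-injective (_ ∷ _)      zero    zero    _  = refl
Unique⇒lookup-injective (x∉xs ∷ _)   zero    (suc j) eq = contradiction eq (All.lookup x∉xs (∈-lookup j))
Unique⇒lookup-injective (x∉xs ∷ _)   (suc i) zero    eq = contradiction (sym eq) (All.lookup x∉xs (∈-lookup i))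
Unique⇒lookup-injective (_ ∷ xs!)    (suc i) (suc j) eq = cong suc (Unique⇒lookup-injective xs! i j eq)

length-filter≤ : {A : Set} {P : Pred A 0ℓ} (P? : Decidable P) {xs : List A} → Unique xs →
                 {N : ℕ} (code : ∀ x → P x → Fin N) →
                 (∀ {x y} {px : P x} {py : P y} → code x px ≡ code y py → x ≡ y) →
                 length (filter P? xs) ≤ N
length-filter≤ P? {xs} xs! {N} code code-injective =
  injective⇒≤ {f = index} λ {i} {j} eq →
    Unique⇒lookup-injective (filter⁺ P? xs!) i j (code-injective eq)
  where
    index : Fin (length (filter P? xs)) → Fin N
    index i = code (List.lookup (filter P? xs) i) (All.lookup (all-filter P? xs) (∈-lookup i))

allFinList-unique : ∀ r → Unique (allFinList r)
allFinList-unique zero    = []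
allFinList-unique (suc r) = map⁺ (All.tabulate λ _ ()) ∷ unique-map⁺ suc-injective (allFinList-unique r)

allMaybe-unique : ∀ r → Unique (allMaybe r)
allMaybe-unique r = map⁺ (All.tabulate λ _ ()) ∷ unique-map⁺ just-injective (allFinList-unique r)

concatMap≡cartesianProductWith : {A B C : Set} (f : A → B → C) (xs : List A) (ys : List B) →
                                 concatMap (λ x → map (f x) ys) xs ≡ cartesianProductWith f xs ys
concatMap≡cartesianProductWith f []       ys = refl
concatMap≡cartesianProductWith f (x ∷ xs) ys = cong (map (f x) ys ++_) (concatMap≡cartesianProductWith f xs ys)

allVecs-unique : ∀ r n → Unique (allVecs r n)
allVecs-unique r zero    = All.[] ∷ []
allVecs-unique r (suc n) =
  subst Unique (sym (concatMap≡cartesianProductWith _∷_ (allMaybe r) (allVecs r n)))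
        (cartesianProductWith⁺ _∷_ ∷-injective (allMaybe-unique r) (allVecs-unique r n))

x∈p─q⇒x∉q : ∀ {n} {p q : Subset n} {x} → x ∈ p ─ q → x ∉ q
x∈p─q⇒x∉q {p = _ ∷ _} {outside ∷ _} here          ()
x∈p─q⇒x∉q {p = _ ∷ _} {_ ∷ _}       (there x∈p─q) (there x∈q) = x∈p─q⇒x∉q x∈p─q x∈q

removeImage : ∀ {n k} → Subset n → (Fin k → Fin n) → Subset n
removeImage {k = zero}  p h = p
removeImage {k = suc k} p h = removeImage (p - h zero) (h ∘ suc)

∈-removeImage : ∀ {n k} {p : Subset n} {h : Fin k → Fin n} {i} →
                i ∈ p → (∀ j → i ≢ h j) → i ∈ removeImage p h
∈-removeImage {k = zero}  i∈p _   = i∈p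
∈-removeImage {k = suc k} i∈p i∉h = ∈-removeImage (x∈p∧x≢y⇒x∈p-y i∈p (i∉h zero)) (i∉h ∘ suc)

∉-removeImage : ∀ {n k} {p : Subset n} (h : Fin k → Fin n) {i} →
                i ∈ p → i ∉ removeImage p h → ∃[ j ] i ≡ h j
∉-removeImage {k = zero}  h     i∈p i∉ = contradiction i∈p i∉
∉-removeImage {k = suc k} h {i} i∈p i∉ with i ≟ h zero
... | yes i≡h0 = zero , i≡h0
... | no  i≢h0 =
  let j , i≡h[1+j] = ∉-removeImage (h ∘ suc) (x∈p∧x≢y⇒x∈p-y i∈p i≢h0) i∉ in suc j , i≡h[1+j]

removeImage-card : ∀ {n k} {p : Subset n} {h : Fin k → Fin n} → Injective _≡_ _≡_ h →
                   (∀ j → h j ∈ p) → k + ∣ removeImage p h ∣ ≤ ∣ p ∣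
removeImage-card {k = zero}          _     _   = ≤-refl
removeImage-card {k = suc k} {p} {h} h-inj h∈p =
  ≤-trans (s≤s (removeImage-card (suc-injective ∘ h-inj) h[suc]∈p-h0)) (x∈p⇒∣p-x∣<∣p∣ (h∈p zero))
  where
    h[suc]∈p-h0 : ∀ j → h (suc j) ∈ p - h zero
    h[suc]∈p-h0 j = x∈p∧x≢y⇒x∈p-y (h∈p (suc j)) (λ eq → 0≢1+n (h-inj (sym eq)))

funToFin-injective : ∀ {m k} {f g : Fin k → Fin m} → funToFin f ≡ funToFin g → ∀ i → f i ≡ g i
funToFin-injective {f = f} {g} eq i =
  trans (sym (finToFun-funToFin f i)) (trans (cong (λ c → finToFun c i) eq) (finToFun-funToFin g i))

module _ {r : ℕ} where

  -- The default colour is never observed: colourings are only read on A, where they are defined.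
  colour : Maybe (Fin (suc r)) → Fin (suc r)
  colour = fromMaybe zero

  encodeOn : ∀ {n} (B : Subset n) → Vec (Maybe (Fin (suc r))) n → Fin (suc r ^ ∣ B ∣)
  encodeOn []            []      = zero
  encodeOn (inside  ∷ B) (c ∷ σ) = combine (colour c) (encodeOn B σ)
  encodeOn (outside ∷ B) (_ ∷ σ) = encodeOn B σ

  encodeOn-injective : ∀ {n} (B : Subset n) {σ τ : Vec (Maybe (Fin (suc r))) n} →
                       encodeOn B σ ≡ encodeOn B τ →
                       ∀ {i} → i ∈ B → colour (lookup σ i) ≡ colour (lookup τ i)
  encodeOn-injective (inside  ∷ B) {c ∷ _} {d ∷ _} eq here =
    combine-injectiveˡ (colour c) _ (colour d) _ eq
  encodeOn-injective (inside  ∷ B) {c ∷ _} {d ∷ _} eq (there i∈B) =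
    encodeOn-injective B (combine-injectiveʳ (colour c) _ (colour d) _ eq) i∈B
  encodeOn-injective (outside ∷ B) {_ ∷ _} {_ ∷ _} eq (there i∈B) = encodeOn-injective B eq i∈B

link-edge-not-monochromatic : ∀ {n r} {A : Subset n} {σ : Vec (Maybe (Fin r)) n} {x u v} →
                              IsValid A σ → x ∈ A → LinkAdj ⁅ x ⁆ (A ─ ⁅ x ⁆) u v →
                              lookup σ u ≡ lookup σ x → lookup σ v ≡ lookup σ x → ⊥
link-edge-not-monochromatic {A = A} {x = x} {u} {v} valid x∈A
                            (u∈A-x , v∈A-x , _ , z , z∈⁅x⁆ , _ , _ , schur) σu≡σx σv≡σx =
  monochromatic (x∈⁅y⁆⇒x≡y x z∈⁅x⁆) schur
  where
    u∈A : u ∈ A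
    u∈A = p─q⊆p A ⁅ x ⁆ u∈A-x
    v∈A : v ∈ A
    v∈A = p─q⊆p A ⁅ x ⁆ v∈A-x
    monochromatic : ∀ {z} → z ≡ x → IsSchurTriple (val u) (val v) (val z) → ⊥
    monochromatic refl (inj₁ u+v≡x)        = valid u v x u∈A v∈A x∈A u+v≡x (trans σu≡σx (sym σv≡σx) , σv≡σx)
    monochromatic refl (inj₂ (inj₁ u+x≡v)) = valid u x v u∈A x∈A v∈A u+x≡v (σu≡σx , sym σv≡σx)
    monochromatic refl (inj₂ (inj₂ v+x≡u)) = valid v x u v∈A x∈A u∈A v+x≡u (σv≡σx , sym σu≡σx)

punchOut-combine-injective : ∀ {k} {c a b c′ a′ b′ : Fin (suc k)}
                             (p : combine c c ≢ combine a b) (q : combine c′ c′ ≢ combine a′ b′) →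
                             c ≡ c′ → punchOut p ≡ punchOut q → a ≡ a′ × b ≡ b′
punchOut-combine-injective p q refl eq = combine-injective _ _ _ _ (punchOut-injective p q eq)

colour-≡⇒≡ : ∀ {n r} {A : Subset n} (σ τ : Vec (Maybe (Fin (suc r))) n) →
             IsColouringOf A σ → IsColouringOf A τ →
             ∀ {i j} → i ∈ A → j ∈ A → colour (lookup σ i) ≡ colour (lookup τ j) → lookup σ i ≡ lookup τ j
colour-≡⇒≡ σ τ σ-colours τ-colours {i} {j} i∈A j∈A eq
  with lookup σ i | lookup τ j | proj₁ (σ-colours i) i∈A | proj₁ (τ-colours j) j∈A
... | just _ | just _ | _ | _ = cong just eq

no-colouring-with-0-colours : ∀ {n} {A : Subset n} {σ : Vec (Maybe (Fin 0)) n} {x} → x ∈ A → ¬ IsColouringOf A σ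
no-colouring-with-0-colours {x = x} x∈A σ-colours with proj₁ (σ-colours x) x∈A
... | () , _

f[A,0]≡0 : ∀ {n} {A : Subset n} {x} → x ∈ A → f A 0 ≡ 0
f[A,0]≡0 {A = A} x∈A =
  cong length (filter-none (isValidColouring? A) {allVecs 0 _}
    (All.tabulate λ {σ} _ → no-colouring-with-0-colours {σ = σ} x∈A ∘ proj₁))

module _ {n : ℕ} {A : Subset n} {x : Fin n} (x∈A : x ∈ A) {m : ℕ} (μ : LinkMatching x (A ─ ⁅ x ⁆) m) where
  open Matching μ

  endpoint : Fin (m + m) → Fin n
  endpoint j = [ u , v ] (splitAt m j)

  endpoint-injective : Injective _≡_ _≡_ endpoint
  endpoint-injective {i} {j} eq = begin
    i                      ≡⟨ sym (join-splitAt m m i) ⟩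
    join m m (splitAt m i) ≡⟨ cong (join m m) (disjoint {splitAt m i} {splitAt m j} eq) ⟩
    join m m (splitAt m j) ≡⟨ join-splitAt m m j ⟩
    j                      ∎
    where open ≡-Reasoning

  endpoint-∈ : ∀ j → endpoint j ∈ A ─ ⁅ x ⁆
  endpoint-∈ j with splitAt m j
  ... | inj₁ k = proj₁ (edge k)
  ... | inj₂ k = proj₁ (proj₂ (edge k))

  unmatched : Subset n
  unmatched = removeImage A endpoint

  x∈unmatched : x ∈ unmatched
  x∈unmatched = ∈-removeImage x∈A λ j x≡endpoint →
    x∈p─q⇒x∉q (endpoint-∈ j) (subst (_∈ ⁅ x ⁆) x≡endpoint (x∈⁅x⁆ x))

  ∣unmatched∣≤∣A∣∸2m : ∣ unmatched ∣ ≤ ∣ A ∣ ∸ 2 * m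
  ∣unmatched∣≤∣A∣∸2m = m+n≤o⇒m≤o∸n ∣ unmatched ∣ (begin
    ∣ unmatched ∣ + 2 * m       ≡⟨ cong (λ k → ∣ unmatched ∣ + (m + k)) (+-identityʳ m) ⟩
    ∣ unmatched ∣ + (m + m)     ≡⟨ +-comm ∣ unmatched ∣ (m + m) ⟩
    m + m + ∣ unmatched ∣       ≤⟨ removeImage-card endpoint-injective (λ j → p─q⊆p A ⁅ x ⁆ (endpoint-∈ j)) ⟩
    ∣ A ∣                       ∎)
    where open ≤-Reasoning

  module _ {r : ℕ} where

    private
      Colouring : Set
      Colouring = Vec (Maybe (Fin (suc r))) n

    -- Fin (r + r * suc r) is Fin (suc r * suc r) with one point punched out.
    edgeColours : (σ : Colouring) → IsValidColouring A σ → Fin m → Fin (r + r * suc r)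
    edgeColours σ (σ-colours , σ-valid) k = punchOut edge-not-monochromatic
      where
        colour-of : Fin n → Fin (suc r)
        colour-of i = colour (lookup σ i)
        same-as-x : ∀ {i} → i ∈ A ─ ⁅ x ⁆ → colour-of x ≡ colour-of i → lookup σ i ≡ lookup σ x
        same-as-x i∈A-x cx≡ci = colour-≡⇒≡ σ σ σ-colours σ-colours (p─q⊆p A ⁅ x ⁆ i∈A-x) x∈A (sym cx≡ci)
        edge-not-monochromatic : combine (colour-of x) (colour-of x) ≢ combine (colour-of (u k)) (colour-of (v k))
        edge-not-monochromatic eq with combine-injective _ _ _ _ eq
        ... | cx≡cu , cx≡cv = link-edge-not-monochromatic {σ = σ} σ-valid x∈A (edge k)
                                (same-as-x (proj₁ (edge k)) cx≡cu) (same-as-x (proj₁ (proj₂ (edge k))) cx≡cv)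

    edgeCode : (σ : Colouring) → IsValidColouring A σ → Fin ((r + r * suc r) ^ m)
    edgeCode σ σ-valid = funToFin (edgeColours σ σ-valid)

    encode : (σ : Colouring) → IsValidColouring A σ → Fin ((r + r * suc r) ^ m * suc r ^ ∣ unmatched ∣)
    encode σ σ-valid = combine (edgeCode σ σ-valid) (encodeOn unmatched σ)

    encode-injective : ∀ {σ τ} {σ-valid : IsValidColouring A σ} {τ-valid : IsValidColouring A τ} →
                       encode σ σ-valid ≡ encode τ τ-valid → σ ≡ τ
    encode-injective {σ} {τ} {σ-valid} {τ-valid} eq = Pointwise-≡⇒≡ (ext agree)
      where
        same-on-unmatched : ∀ {i} → i ∈ unmatched → colour (lookup σ i) ≡ colour (lookup τ i)
        same-on-unmatched =
          encodeOn-injective unmatched {σ} {τ} (combine-injectiveʳ (edgeCode σ σ-valid) _ (edgeCode τ τ-valid) _ eq)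
        same-on-edge : ∀ k → colour (lookup σ (u k)) ≡ colour (lookup τ (u k)) ×
                             colour (lookup σ (v k)) ≡ colour (lookup τ (v k))
        same-on-edge k = punchOut-combine-injective _ _ (same-on-unmatched x∈unmatched)
          (funToFin-injective (combine-injectiveˡ (edgeCode σ σ-valid) _ (edgeCode τ τ-valid) _ eq) k)
        same-on-endpoint : ∀ j → colour (lookup σ (endpoint j)) ≡ colour (lookup τ (endpoint j))
        same-on-endpoint j with splitAt m j
        ... | inj₁ k = proj₁ (same-on-edge k)
        ... | inj₂ k = proj₂ (same-on-edge k)
        same-on-A : ∀ {i} → i ∈ A → colour (lookup σ i) ≡ colour (lookup τ i)
        same-on-A {i} i∈A with i ∈? unmatched
        ... | yes i∈unmatched = same-on-unmatched i∈unmatched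
        ... | no  i∉unmatched with ∉-removeImage endpoint i∈A i∉unmatched
        ...   | j , refl = same-on-endpoint j
        agree : ∀ i → lookup σ i ≡ lookup τ i
        agree i with i ∈? A
        ... | yes i∈A = colour-≡⇒≡ σ τ (proj₁ σ-valid) (proj₁ τ-valid) i∈A i∈A (same-on-A i∈A)
        ... | no  i∉A = trans (proj₂ (proj₁ σ-valid i) i∉A) (sym (proj₂ (proj₁ τ-valid i) i∉A))

lemma5p2 : (n r : ℕ) (A : Subset n) (x : Fin n) → x ∈ A → (m : ℕ) →
           LinkMatching x (A ─ ⁅ x ⁆) m →
           f A r ≤ (r ^ 2 ∸ 1) ^ m * r ^ (∣ A ∣ ∸ 2 * m)
lemma5p2 n zero    A x x∈A m μ = ≤-trans (≤-reflexive (f[A,0]≡0 x∈A)) z≤n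
lemma5p2 n (suc r) A x x∈A m μ = begin
  f A (suc r)                                       ≤⟨ f≤#codes ⟩
  (r + r * suc r) ^ m * suc r ^ ∣ unmatched x∈A μ ∣ ≤⟨ *-monoʳ-≤ ((r + r * suc r) ^ m)
                                                         (^-monoʳ-≤ (suc r) (∣unmatched∣≤∣A∣∸2m x∈A μ)) ⟩
  (r + r * suc r) ^ m * suc r ^ (∣ A ∣ ∸ 2 * m)     ≡⟨ cong (λ k → k ^ m * suc r ^ (∣ A ∣ ∸ 2 * m)) [1+r]²∸1 ⟩
  (suc r ^ 2 ∸ 1) ^ m * suc r ^ (∣ A ∣ ∸ 2 * m)     ∎
  where
    open ≤-Reasoning
    f≤#codes : f A (suc r) ≤ (r + r * suc r) ^ m * suc r ^ ∣ unmatched x∈A μ ∣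
    f≤#codes = length-filter≤ (isValidColouring? A) (allVecs-unique (suc r) n) (encode x∈A μ)
                 λ {_} {_} {p} {q} → encode-injective x∈A μ {σ-valid = p} {τ-valid = q}
    [1+r]²∸1 : r + r * suc r ≡ suc r ^ 2 ∸ 1
    [1+r]²∸1 = cong (λ k → suc r * k ∸ 1) (sym (*-identityʳ (suc r)))
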